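{- For $n\ge1$, the number of inversion sequences $e\in\mathbf{I}_n$ with no index $i$ such that $e_i=e_{i+1}\neq e_{i+2}$ equals $0!+1!+2!+\dots+(n-1)!$.
   Context: An inversion sequence of length $n$ is an integer sequence $e=e_1\dots e_n$ with $0\le e_i<i$ for all $i$; $\mathbf{I}_n$ is the set of these. (In the paper's notation this is $|\mathbf{I}_n(\underline{=,\neq})|$.) -}

module Defs where

open import Data.Nat using (ℕ; zero; suc; _+_; _<_)
open import Data.Nat using (_!)
open import Data.List using (List; []; _∷_; concatMap; map; length; filter; upTo; _++_; [_])
open import Data.Nat using (_≟_)
open import Data.Product using (_×_; _,_)
open import Data.Sum using (_⊎_)
open import Relation.Nullary using (¬_; Dec; yes; no)
open import Relation.Nullary.Decidable using (_×-dec_; _⊎-dec_; ¬?)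
open import Relation.Binary.PropositionalEquality using (_≡_)

-- An inversion sequence e₁…eₙ (with 0 ≤ eᵢ < i) is represented as the list
-- [e₁, …, eₙ] of natural numbers.
InvSeqs : ℕ → List (List ℕ)
InvSeqs zero = [] ∷ []
InvSeqs (suc n) = concatMap (λ e → map (λ k → e ++ [ k ]) (upTo (suc n))) (InvSeqs n)


data HasPattern : List ℕ → Set where
  here  : ∀ {a b c rest} → a ≡ b → ¬ (b ≡ c) → HasPattern (a ∷ b ∷ c ∷ rest)
  there : ∀ {a rest} → HasPattern rest → HasPattern (a ∷ rest)

hasPattern? : (e : List ℕ) → Dec (HasPattern e)
hasPattern? [] = no λ ()
hasPattern? (a ∷ []) = no λ { (there ()) }
hasPattern? (a ∷ b ∷ []) = no λ { (there (there ())) }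
hasPattern? (a ∷ b ∷ c ∷ rest) with a ≟ b | b ≟ c | hasPattern? (b ∷ c ∷ rest)
... | yes p | no q | _ = yes (here p q)
... | _ | _ | yes h = yes (there h)
... | no p | _ | no h = no λ { (here p' _) → p p' ; (there h') → h h' }
... | yes _ | yes q | no h = no λ { (here _ q') → q' q ; (there h') → h h' }

avoidCount : ℕ → ℕ
avoidCount n = length (filter (λ e → ¬? (hasPattern? e)) (InvSeqs n))

factSum : ℕ → ℕ
factSum zero = 0
factSum (suc n) = factSum n + n !

module Submission where

-- Read a sequence from left to right and classify it into
-- one of three states: it contains the pattern eᵢ = eᵢ₊₁ ≠ eᵢ₊₂ (blocked);
-- it avoids the pattern and its last two entries are equal (tied); or it
-- avoids the pattern otherwise (plain).  Appending an entry k changes the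
-- state by a transition `step` that depends only on whether k equals the
-- current last entry (status-snoc).  The inversion sequences of length n+2
-- are exactly the extensions of those of length n+1 (whose last entry is at
-- most n) by an entry k ∈ {0,…,n+1}; exactly one such k repeats the last
-- entry and n+1 of them do not (count-upTo-by-equality).  Counting states
-- through one extension step (count-extensions) therefore gives, for the
-- numbers pₙ, tₙ of plain and tied sequences of length n+1,
--     pₙ₊₁ = (n+1)·pₙ    and    tₙ₊₁ = pₙ + tₙ,
-- so pₙ = n! and the number of avoiders pₙ + tₙ grows by (n+1)! at each
-- step, summing to 0! + 1! + … + n!.

open import Defs
open import Data.Nat using (ℕ; zero; suc; _+_; _*_; _≤_; _≟_; _!)
open import Data.Nat.Properties using (suc-injective; ≤-pred; m≤n⇒m≤1+n; +-assoc; +-comm; +-identityʳ; *-zeroʳ)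
open import Data.Nat.Solver using (module +-*-Solver)
open import Data.Bool using (Bool; true; false; not; _∧_)
open import Data.List using (List; []; _∷_; _++_; [_]; map; length; filter; upTo; applyUpTo; concatMap)
open import Data.List.Properties using (map-upTo; length-upTo)
open import Data.List.Relation.Unary.All using (All; []; _∷_; universal)
import Data.List.Relation.Unary.All as All
open import Data.List.Relation.Unary.All.Properties using (all-upTo; map⁺; concat⁺)
open import Data.Empty using (⊥; ⊥-elim)
open import Level using (Level)
open import Function using (_∘_)
open import Relation.Nullary using (yes; no; does)
open import Relation.Nullary.Decidable using (⌊_⌋; ¬?)
open import Relation.Unary using (Pred; Decidable)
open import Relation.Binary.PropositionalEquality using (_≡_; _≢_; refl; sym; trans; cong; cong₂; subst)
open Relation.Binary.PropositionalEquality.≡-Reasoning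
open +-*-Solver using (solve; _:+_; _:*_; _:=_)

ind : Bool → ℕ
ind true = 1
ind false = 0

count : {A : Set} → (A → Bool) → List A → ℕ
count p [] = 0
count p (x ∷ xs) = ind (p x) + count p xs

length-filter : {A : Set} {ℓ : Level} {P : Pred A ℓ} (P? : Decidable P) (xs : List A) →
                length (filter P? xs) ≡ count (λ x → does (P? x)) xs
length-filter P? [] = refl
length-filter P? (x ∷ xs) with does (P? x)
... | true = cong suc (length-filter P? xs)
... | false = length-filter P? xs

count-cong : {A : Set} {p q : A → Bool} → (∀ x → p x ≡ q x) → (xs : List A) → count p xs ≡ count q xs
count-cong p≗q [] = refl
count-cong p≗q (x ∷ xs) = cong₂ _+_ (cong ind (p≗q x)) (count-cong p≗q xs)

count-none : {A : Set} {p : A → Bool} → (∀ x → p x ≡ false) → (xs : List A) → count p xs ≡ 0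
count-none never [] = refl
count-none never (x ∷ xs) = cong₂ _+_ (cong ind (never x)) (count-none never xs)

count-const : {A : Set} (b : Bool) (xs : List A) → count (λ _ → b) xs ≡ length xs * ind b
count-const b [] = refl
count-const b (x ∷ xs) = cong (ind b +_) (count-const b xs)

count-++ : {A : Set} (p : A → Bool) (xs ys : List A) → count p (xs ++ ys) ≡ count p xs + count p ys
count-++ p [] ys = refl
count-++ p (x ∷ xs) ys = trans (cong (ind (p x) +_) (count-++ p xs ys)) (sym (+-assoc (ind (p x)) _ _))

count-map : {A B : Set} (p : B → Bool) (f : A → B) (xs : List A) → count p (map f xs) ≡ count (p ∘ f) xs
count-map p f [] = refl
count-map p f (x ∷ xs) = cong (ind (p (f x)) +_) (count-map p f xs)

count-split : {A : Set} {p q r : A → Bool} → (∀ x → ind (p x) ≡ ind (q x) + ind (r x)) →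
              (xs : List A) → count p xs ≡ count q xs + count r xs
count-split split [] = refl
count-split {p = p} {q} {r} split (x ∷ xs) = begin
  ind (p x) + count p xs                                  ≡⟨ cong₂ _+_ (split x) (count-split split xs) ⟩
  (ind (q x) + ind (r x)) + (count q xs + count r xs)
    ≡⟨ solve 4 (λ a b c d → (a :+ b) :+ (c :+ d) := (a :+ c) :+ (b :+ d)) refl
             (ind (q x)) (ind (r x)) (count q xs) (count r xs) ⟩
  (ind (q x) + count q xs) + (ind (r x) + count r xs) ∎

count-shift : (p : ℕ → Bool) (n : ℕ) → count p (applyUpTo suc n) ≡ count (p ∘ suc) (upTo n)
count-shift p n = trans (cong (count p) (sym (map-upTo suc n))) (count-map p suc (upTo n))

≟-suc : (l k : ℕ) → ⌊ suc l ≟ suc k ⌋ ≡ ⌊ l ≟ k ⌋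
≟-suc l k with l ≟ k | suc l ≟ suc k
... | yes _ | yes _ = refl
... | no _ | no _ = refl
... | yes l≡k | no l+1≢k+1 = ⊥-elim (l+1≢k+1 (cong suc l≡k))
... | no l≢k | yes l+1≡k+1 = ⊥-elim (l≢k (suc-injective l+1≡k+1))

-- Among 0,…,m exactly one number equals a given l ≤ m and m numbers differ
-- from it; so a predicate that only sees "k = l?" is counted linearly in m.
count-upTo-by-equality : (g : Bool → Bool) {l m : ℕ} → l ≤ m →
  count (λ k → g ⌊ l ≟ k ⌋) (upTo (suc m)) ≡ ind (g true) + m * ind (g false)
count-upTo-by-equality g {zero} {m} _ = cong (ind (g true) +_) (begin
  count (λ k → g ⌊ 0 ≟ k ⌋) (applyUpTo suc m)  ≡⟨ count-shift (λ k → g ⌊ 0 ≟ k ⌋) m ⟩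
  count (λ _ → g false) (upTo m)               ≡⟨ count-const (g false) (upTo m) ⟩
  length (upTo m) * ind (g false)              ≡⟨ cong (_* ind (g false)) (length-upTo m) ⟩
  m * ind (g false)                            ∎)
count-upTo-by-equality g {suc l} {suc m} l+1≤m+1 = begin
  ind (g false) + count (λ k → g ⌊ suc l ≟ k ⌋) (applyUpTo suc (suc m))
    ≡⟨ cong (ind (g false) +_) (count-shift (λ k → g ⌊ suc l ≟ k ⌋) (suc m)) ⟩
  ind (g false) + count (λ k → g ⌊ suc l ≟ suc k ⌋) (upTo (suc m))
    ≡⟨ cong (ind (g false) +_) (count-cong (λ k → cong g (≟-suc l k)) (upTo (suc m))) ⟩
  ind (g false) + count (λ k → g ⌊ l ≟ k ⌋) (upTo (suc m))
    ≡⟨ cong (ind (g false) +_) (count-upTo-by-equality g (≤-pred l+1≤m+1)) ⟩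
  ind (g false) + (ind (g true) + m * ind (g false))
    ≡⟨ solve 3 (λ f t m → f :+ (t :+ m :* f) := t :+ (f :+ m :* f)) refl (ind (g false)) (ind (g true)) m ⟩
  ind (g true) + suc m * ind (g false) ∎

data Status : Set where
  blocked : Status   -- the pattern occurs
  tied    : Status   -- the pattern is avoided and the last two entries are equal
  plain   : Status   -- the pattern is avoided otherwise

-- The change of state when an entry is appended, given whether it repeats
-- the current last entry.
step : Status → Bool → Status
step blocked _ = blocked
step tied true = tied
step tied false = blocked
step plain true = tied
step plain false = plain

blockIf : Bool → Status → Status
blockIf true _ = blocked
blockIf false s = s

status : List ℕ → Status
status (a ∷ b ∷ c ∷ r) = blockIf (⌊ a ≟ b ⌋ ∧ not ⌊ b ≟ c ⌋) (status (b ∷ c ∷ r))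
status (a ∷ b ∷ []) = step plain ⌊ a ≟ b ⌋
status (a ∷ []) = plain
status [] = plain

blockIf-blocked : (c : Bool) → blockIf c blocked ≡ blocked
blockIf-blocked true = refl
blockIf-blocked false = refl

step-plain-unblocked : (b : Bool) → step plain b ≢ blocked
step-plain-unblocked true ()
step-plain-unblocked false ()

status-of-pattern : {e : List ℕ} → HasPattern e → status e ≡ blocked
status-of-pattern (here {a} {b} {c} a≡b b≢c) with a ≟ b | b ≟ c
... | yes _ | no _ = refl
... | yes _ | yes b≡c = ⊥-elim (b≢c b≡c)
... | no a≢b | _ = ⊥-elim (a≢b a≡b)
status-of-pattern (there {rest = _ ∷ _ ∷ _} h) = trans (cong (blockIf _) (status-of-pattern h)) (blockIf-blocked _)
status-of-pattern (there {rest = _ ∷ []} (there ()))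

pattern-at-front-or-tail : (a b c : ℕ) {r : List ℕ} →
  (status (b ∷ c ∷ r) ≡ blocked → HasPattern (b ∷ c ∷ r)) →
  status (a ∷ b ∷ c ∷ r) ≡ blocked → HasPattern (a ∷ b ∷ c ∷ r)
pattern-at-front-or-tail a b c tail-pattern blocked-e with a ≟ b | b ≟ c
... | yes a≡b | no b≢c = here a≡b b≢c
... | yes _ | yes _ = there (tail-pattern blocked-e)
... | no _ | _ = there (tail-pattern blocked-e)

pattern-of-status : (e : List ℕ) → status e ≡ blocked → HasPattern e
pattern-of-status (a ∷ b ∷ c ∷ r) = pattern-at-front-or-tail a b c (pattern-of-status (b ∷ c ∷ r))
pattern-of-status (a ∷ b ∷ []) blocked-e = ⊥-elim (step-plain-unblocked ⌊ a ≟ b ⌋ blocked-e)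
pattern-of-status (a ∷ []) ()
pattern-of-status [] ()

isLive : Status → Bool
isLive blocked = false
isLive tied = true
isLive plain = true

avoids-iff-live : (e : List ℕ) → does (¬? (hasPattern? e)) ≡ isLive (status e)
avoids-iff-live e with hasPattern? e
... | yes h = sym (cong isLive (status-of-pattern h))
... | no ¬h = sym (live-unless-blocked (status e) (¬h ∘ pattern-of-status e))
  where
  live-unless-blocked : (s : Status) → s ≢ blocked → isLive s ≡ true
  live-unless-blocked blocked s≢blocked = ⊥-elim (s≢blocked refl)
  live-unless-blocked tied _ = refl
  live-unless-blocked plain _ = refl

avoidCount-as-count : (n : ℕ) → avoidCount n ≡ count (isLive ∘ status) (InvSeqs n)
avoidCount-as-count n =
  trans (length-filter (λ e → ¬? (hasPattern? e)) (InvSeqs n)) (count-cong avoids-iff-live (InvSeqs n))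

last : ℕ → List ℕ → ℕ
last x [] = x
last x (y ∷ ys) = last y ys

last-snoc : (x : ℕ) (xs : List ℕ) (k : ℕ) → last x (xs ++ [ k ]) ≡ k
last-snoc x [] k = refl
last-snoc x (y ∷ ys) k = last-snoc y ys k

blockIf-step : (c : Bool) (s : Status) (d : Bool) → blockIf c (step s d) ≡ step (blockIf c s) d
blockIf-step true s d = refl
blockIf-step false s d = refl

step-plain-twice : (b d : Bool) → blockIf (b ∧ not d) (step plain d) ≡ step (step plain b) d
step-plain-twice true true = refl
step-plain-twice true false = refl
step-plain-twice false true = refl
step-plain-twice false false = refl

status-snoc : (x : ℕ) (xs : List ℕ) (k : ℕ) →
              status (x ∷ xs ++ [ k ]) ≡ step (status (x ∷ xs)) ⌊ last x xs ≟ k ⌋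
status-snoc x [] k = refl
status-snoc x (y ∷ []) k = step-plain-twice ⌊ x ≟ y ⌋ ⌊ y ≟ k ⌋
status-snoc x (y ∷ z ∷ zs) k =
  trans (cong (blockIf c) (status-snoc y (z ∷ zs) k)) (blockIf-step c (status (y ∷ z ∷ zs)) _)
  where c = ⌊ x ≟ y ⌋ ∧ not ⌊ y ≟ z ⌋

LastAtMost : ℕ → List ℕ → Set
LastAtMost m [] = ⊥
LastAtMost m (x ∷ xs) = last x xs ≤ m

LastAtMost-weaken : {m : ℕ} (e : List ℕ) → LastAtMost m e → LastAtMost (suc m) e
LastAtMost-weaken (x ∷ xs) = m≤n⇒m≤1+n

-- The extensions of e by a last entry k ∈ {0,…,m}; by definition
-- InvSeqs (suc n) = concatMap (extensions n) (InvSeqs n).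
extensions : ℕ → List ℕ → List (List ℕ)
extensions m e = map (λ k → e ++ [ k ]) (upTo (suc m))

extensions-last : (m : ℕ) (e : List ℕ) → All (LastAtMost m) (extensions m e)
extensions-last m e = map⁺ (All.map (λ k<m+1 → snoc-last e (≤-pred k<m+1)) (all-upTo (suc m)))
  where
  snoc-last : (e : List ℕ) {k : ℕ} → k ≤ m → LastAtMost m (e ++ [ k ])
  snoc-last [] k≤m = k≤m
  snoc-last (x ∷ xs) {k} k≤m = subst (_≤ m) (sym (last-snoc x xs k)) k≤m

InvSeqs-last : (n : ℕ) → All (LastAtMost n) (InvSeqs (suc n))
InvSeqs-last n = concat⁺ (map⁺ (universal (extensions-last n) (InvSeqs n)))

-- How a state predicate g is counted over the extensions of one sequence:
-- one extension repeats the last entry, the other m do not.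
count-extension : (g : Status → Bool) {m : ℕ} (e : List ℕ) → LastAtMost m e →
  count (g ∘ status) (extensions m e) ≡ ind (g (step (status e) true)) + m * ind (g (step (status e) false))
count-extension g {m} (x ∷ xs) last≤m = begin
  count (g ∘ status) (map (λ k → x ∷ xs ++ [ k ]) (upTo (suc m)))
    ≡⟨ count-map (g ∘ status) (λ k → x ∷ xs ++ [ k ]) (upTo (suc m)) ⟩
  count (λ k → g (status (x ∷ xs ++ [ k ]))) (upTo (suc m))
    ≡⟨ count-cong (λ k → cong g (status-snoc x xs k)) (upTo (suc m)) ⟩
  count (λ k → g (step (status (x ∷ xs)) ⌊ last x xs ≟ k ⌋)) (upTo (suc m))
    ≡⟨ count-upTo-by-equality (g ∘ step (status (x ∷ xs))) last≤m ⟩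
  ind (g (step (status (x ∷ xs)) true)) + m * ind (g (step (status (x ∷ xs)) false)) ∎

count-extensions : (g : Status → Bool) (m : ℕ) (es : List (List ℕ)) → All (LastAtMost m) es →
  count (g ∘ status) (concatMap (extensions m) es)
    ≡ count (λ e → g (step (status e) true)) es + m * count (λ e → g (step (status e) false)) es
count-extensions g m [] [] = sym (*-zeroʳ m)
count-extensions g m (e ∷ es) (last≤m ∷ lasts≤m) = begin
  count (g ∘ status) (extensions m e ++ concatMap (extensions m) es)
    ≡⟨ count-++ (g ∘ status) (extensions m e) _ ⟩
  count (g ∘ status) (extensions m e) + count (g ∘ status) (concatMap (extensions m) es)
    ≡⟨ cong₂ _+_ (count-extension g e last≤m) (count-extensions g m es lasts≤m) ⟩
  (ind (g (step (status e) true)) + m * ind (g (step (status e) false))) + (R + m * F)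
    ≡⟨ solve 5 (λ r f m R F → (r :+ m :* f) :+ (R :+ m :* F) := (r :+ R) :+ m :* (f :+ F)) refl
             (ind (g (step (status e) true))) (ind (g (step (status e) false))) m R F ⟩
  (ind (g (step (status e) true)) + R) + m * (ind (g (step (status e) false)) + F) ∎
  where
  R = count (λ e → g (step (status e) true)) es
  F = count (λ e → g (step (status e) false)) es

isPlain isTied : Status → Bool
isPlain plain = true
isPlain _ = false
isTied tied = true
isTied _ = false

plain-after-repeat : (s : Status) → isPlain (step s true) ≡ false
plain-after-repeat blocked = refl
plain-after-repeat tied = refl
plain-after-repeat plain = refl

plain-after-change : (s : Status) → isPlain (step s false) ≡ isPlain s
plain-after-change blocked = refl
plain-after-change tied = refl
plain-after-change plain = refl

tied-after-repeat : (s : Status) → isTied (step s true) ≡ isLive s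
tied-after-repeat blocked = refl
tied-after-repeat tied = refl
tied-after-repeat plain = refl

tied-after-change : (s : Status) → isTied (step s false) ≡ false
tied-after-change blocked = refl
tied-after-change tied = refl
tied-after-change plain = refl

live-split : (s : Status) → ind (isLive s) ≡ ind (isPlain s) + ind (isTied s)
live-split blocked = refl
live-split tied = refl
live-split plain = refl

-- Numbers of plain, tied and live inversion sequences of length n+1.
plainCount tiedCount liveCount : ℕ → ℕ
plainCount n = count (isPlain ∘ status) (InvSeqs (suc n))
tiedCount n = count (isTied ∘ status) (InvSeqs (suc n))
liveCount n = count (isLive ∘ status) (InvSeqs (suc n))

extendable : (n : ℕ) → All (LastAtMost (suc n)) (InvSeqs (suc n))
extendable n = All.map (λ {e} → LastAtMost-weaken e) (InvSeqs-last n)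

-- pₙ₊₁ = (n+1)·pₙ: a plain sequence stays plain under each of the n+1
-- non-repeating extensions, and nothing else becomes plain.
plainCount-suc : (n : ℕ) → plainCount (suc n) ≡ suc n * plainCount n
plainCount-suc n = begin
  plainCount (suc n)
    ≡⟨ count-extensions isPlain (suc n) es (extendable n) ⟩
  count (λ e → isPlain (step (status e) true)) es + suc n * count (λ e → isPlain (step (status e) false)) es
    ≡⟨ cong₂ (λ r f → r + suc n * f) (count-none (λ e → plain-after-repeat (status e)) es)
                                     (count-cong (λ e → plain-after-change (status e)) es) ⟩
  suc n * plainCount n ∎
  where es = InvSeqs (suc n)

-- tₙ₊₁ = pₙ + tₙ: exactly the live sequences extended by a repeat become tied.
tiedCount-suc : (n : ℕ) → tiedCount (suc n) ≡ liveCount n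
tiedCount-suc n = begin
  tiedCount (suc n)
    ≡⟨ count-extensions isTied (suc n) es (extendable n) ⟩
  count (λ e → isTied (step (status e) true)) es + suc n * count (λ e → isTied (step (status e) false)) es
    ≡⟨ cong₂ (λ r f → r + suc n * f) (count-cong (λ e → tied-after-repeat (status e)) es)
                                     (count-none (λ e → tied-after-change (status e)) es) ⟩
  liveCount n + suc n * 0
    ≡⟨ trans (cong (liveCount n +_) (*-zeroʳ (suc n))) (+-identityʳ (liveCount n)) ⟩
  liveCount n ∎
  where es = InvSeqs (suc n)

plainCount-factorial : (n : ℕ) → plainCount n ≡ n !
plainCount-factorial zero = refl
plainCount-factorial (suc n) = trans (plainCount-suc n) (cong (suc n *_) (plainCount-factorial n))

liveCount-factSum : (n : ℕ) → liveCount n ≡ factSum (suc n)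
liveCount-factSum zero = refl
liveCount-factSum (suc n) = begin
  liveCount (suc n)              ≡⟨ count-split (λ e → live-split (status e)) (InvSeqs (suc (suc n))) ⟩
  plainCount (suc n) + tiedCount (suc n)
                                 ≡⟨ cong₂ _+_ (plainCount-factorial (suc n)) (tiedCount-suc n) ⟩
  suc n ! + liveCount n          ≡⟨ cong (suc n ! +_) (liveCount-factSum n) ⟩
  suc n ! + factSum (suc n)      ≡⟨ +-comm (suc n !) (factSum (suc n)) ⟩
  factSum (suc (suc n))          ∎

proposition4p24 : (n : ℕ) → avoidCount (suc n) ≡ factSum (suc n)
proposition4p24 n = trans (avoidCount-as-count (suc n)) (liveCount-factSum n)
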